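{- Let $R$ be a finite commutative local ring with nonzero identity and characteristic $4$. Then the involutory Cayley graph $\Gamma(R)$ is connected and $4$-regular if and only if $R \cong \mathbb{Z}_4[x]/\langle x^2, 2x\rangle$.
   Context: The involutory Cayley graph $\Gamma(R)$ of a ring $R$ is the simple undirected graph with vertex set $R$ in which distinct $x,y$ are adjacent if and only if $(x-y)^2 = 1$. -}

module Defs where

open import Level using (Level; _⊔_; 0ℓ)
open import Data.Nat using (ℕ; zero; suc; _<_) renaming (_+_ to _+ℕ_; _*_ to _*ℕ_)
open import Data.Nat.DivMod using (_mod_)
open import Data.Fin using (Fin; toℕ) renaming (zero to fzero; suc to fsuc)
open import Data.Product using (Σ; ∃; _×_; _,_)
open import Data.List using (List)
open import Relation.Nullary using (¬_)
open import Relation.Binary.PropositionalEquality using (_≡_)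
open import Algebra.Bundles using (CommutativeRing)
open import Algebra.Bundles.Raw using (RawRing)
open import Algebra.Morphism.Structures using (module RingMorphisms)

private variable c ℓ : Level

module _ (R : CommutativeRing c ℓ) where
  open CommutativeRing R

  natMul : ℕ → Carrier → Carrier
  natMul zero    x = 0#
  natMul (suc n) x = x + natMul n x

  HasCharacteristic : ℕ → Set ℓ
  HasCharacteristic n =
    (0 < n) × (natMul n 1# ≈ 0#) × (∀ m → 0 < m → m < n → ¬ (natMul m 1# ≈ 0#))

  Finite : Set (c ⊔ ℓ)
  Finite = Σ ℕ λ n → Σ (Fin n → Carrier) λ e → ∀ x → ∃ λ i → e i ≈ x

  IsUnit : Carrier → Set (c ⊔ ℓ)
  IsUnit x = ∃ λ y → x * y ≈ 1#

  -- local ring: 1 ≠ 0 and the non-units are closed under addition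
  -- (equivalently, the non-units form the unique maximal ideal)
  IsLocal : Set (c ⊔ ℓ)
  IsLocal = (¬ (1# ≈ 0#)) × (∀ x y → ¬ IsUnit x → ¬ IsUnit y → ¬ IsUnit (x + y))

  Adj : Carrier → Carrier → Set ℓ
  Adj x y = (¬ (x ≈ y)) × ((x - y) * (x - y) ≈ 1#)

  data Reachable : Carrier → Carrier → Set (c ⊔ ℓ) where
    here : ∀ {x y} → x ≈ y → Reachable x y
    step : ∀ {x y z} → Adj x y → Reachable y z → Reachable x z

  Connected : Set (c ⊔ ℓ)
  Connected = ∀ x y → Reachable x y

  HasDegree : Carrier → ℕ → Set (c ⊔ ℓ)
  HasDegree x d = Σ (Fin d → Carrier) λ v →
    (∀ i j → v i ≈ v j → i ≡ j) ×
    (∀ i → Adj x (v i)) ×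
    (∀ y → Adj x y → ∃ λ i → y ≈ v i)

  Regular : ℕ → Set (c ⊔ ℓ)
  Regular d = ∀ x → HasDegree x d

-- ℤ₄[x]/⟨x², 2x⟩ : every element is uniquely a + b x with a ∈ ℤ₄, b ∈ ℤ₂
-- (x² = 0 and 2x = 0). Represented as pairs (a , b).
-- (a + b x) + (c + d x) = (a + c) + (b + d) x
-- (a + b x) (c + d x)   = a c + (a d + b c) x
Z4x : RawRing 0ℓ 0ℓ
Z4x = record
  { Carrier = Fin 4 × Fin 2
  ; _≈_ = _≡_
  ; _+_ = λ { (a , b) (c , d) → ((toℕ a +ℕ toℕ c) mod 4) , ((toℕ b +ℕ toℕ d) mod 2) }
  ; _*_ = λ { (a , b) (c , d) → ((toℕ a *ℕ toℕ c) mod 4)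
                              , ((toℕ a *ℕ toℕ d +ℕ toℕ b *ℕ toℕ c) mod 2) }
  ; -_ = λ { (a , b) → ((3 *ℕ toℕ a) mod 4) , (toℕ b mod 2) }
  ; 0# = (fzero , fzero)
  ; 1# = (fsuc fzero , fzero)
  }

_≅ᵣ_ : {a ℓ₁ b ℓ₂ : Level} → RawRing a ℓ₁ → RawRing b ℓ₂ → Set (a ⊔ b ⊔ ℓ₁ ⊔ ℓ₂)
R ≅ᵣ S = Σ (RawRing.Carrier R → RawRing.Carrier S) (RingMorphisms.IsRingIsomorphism R S)

{-# OPTIONS --safe #-}
module Submission where

-- The neighbours of x in Γ(R) are the x + u with u an involution (u² = 1), so Γ(R) is connected
-- iff every element is a sum of involutions, and d-regular iff R has exactly d involutions.
-- In characteristic 4 take an involution u ≠ ±1: then 1, -1, u, -u are the four involutions, and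
-- u + 2, being an involution different from 1, -1 and u, equals -u. Hence a = u - 1 satisfies
-- 2a = 0 and a² = 0, so evaluating x at a is a ring map ℤ₄[x]/⟨x², 2x⟩ → R; it is injective
-- (its kernel is checked on the eight elements) and onto, as its image contains every involution.
-- Conversely ℤ₄[x]/⟨x², 2x⟩ has exactly the four involutions ±1, ±1 + x, which generate it
-- additively, and connectivity and regularity are invariant under ring isomorphisms.

open import Defs
open import Level using (Level; _⊔_; 0ℓ)
open import Data.Nat using (zero; suc; NonZero; z<s; s<s) renaming (_+_ to _+ℕ_; _*_ to _*ℕ_)
open import Data.Nat.DivMod using (_mod_; _%_; _/_; m≡m%n+[m/n]*n; m%n<n)
import Data.Nat.Properties as ℕ
open import Data.Fin using (Fin; toℕ; #_) renaming (zero to fzero; suc to fsuc)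
open import Data.Fin.Properties using (all?; any?; _≟_; toℕ-fromℕ<)
open import Data.List using (List; []; _∷_; foldr; replicate; _++_)
open import Data.List.Relation.Unary.All using (All; []; _∷_)
import Data.List.Relation.Unary.All as All
import Data.Maybe as Maybe
open import Data.Product using (∃; _×_; _,_; proj₁; proj₂)
open import Data.Product.Properties using (≡-dec)
open import Data.Sum using (_⊎_; inj₁; inj₂)
import Data.Sum as Sum
open import Data.Empty using (⊥-elim)
open import Function.Base using (_∘_)
open import Function.Bundles using (_⇔_; mk⇔; Equivalence)
open import Relation.Nullary using (¬_; Dec)
open import Relation.Nullary.Decidable using (from-yes; map′; ¬?; _×-dec_; _⊎-dec_; _→-dec_; dec⇒maybe)
open import Relation.Binary.PropositionalEquality using (_≡_; _≢_; cong; cong₂)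
import Relation.Binary.PropositionalEquality as ≡
open import Algebra.Bundles using (Monoid; CommutativeRing)
open import Algebra.Bundles.Raw using (RawRing)
open import Algebra.Structures using (IsCommutativeRing)
open import Algebra.Morphism.Structures using (module RingMorphisms)
open import Algebra.Solver.Ring.AlmostCommutativeRing using (fromCommutativeRing; _-Raw-AlmostCommutative⟶_)
import Algebra.Properties.AbelianGroup as AbelianGroupProperties
import Algebra.Properties.CommutativeSemigroup as CommutativeSemigroupProperties
import Algebra.Properties.Group as GroupProperties
import Algebra.Properties.Monoid.Mult as MonoidMultProperties
import Algebra.Properties.Ring as RingProperties
import Algebra.Properties.Semiring.Mult as SemiringMultProperties
import Algebra.Solver.Ring as RingSolver
import Relation.Binary.Reasoning.Setoid as SetoidReasoning

private variable c ℓ : Level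

module _ (R : CommutativeRing c ℓ) where
  open CommutativeRing R
  open GroupProperties +-group
    using (x∙y⁻¹≈ε⇒x≈y; x≈y⇒x∙y⁻¹≈ε; ∙-cancelʳ; \\-leftDividesʳ; //-rightDividesˡ; //-rightDividesʳ; ⁻¹-involutive; ε⁻¹≈ε)
  open AbelianGroupProperties +-abelianGroup using (⁻¹-anti-homo‿-)
  open RingProperties ring using (-‿distribˡ-*; -‿distribʳ-*)
  open SetoidReasoning setoid

  Involution : Carrier → Set ℓ
  Involution u = u * u ≈ 1#

  Involution-resp-≈ : ∀ {u v} → u ≈ v → Involution u → Involution v
  Involution-resp-≈ u≈v u²≈1 = trans (*-cong (sym u≈v) (sym u≈v)) u²≈1

  sum : List Carrier → Carrier
  sum = foldr _+_ 0#

  SumOfInvolutions : Carrier → Set (c ⊔ ℓ)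
  SumOfInvolutions x = ∃ λ us → All Involution us × x ≈ sum us

  Adj-resp-≈ : ∀ {x x′ y y′} → x ≈ x′ → y ≈ y′ → Adj R x y → Adj R x′ y′
  Adj-resp-≈ x≈x′ y≈y′ (x≉y , [x-y]²≈1) =
    (λ x′≈y′ → x≉y (trans x≈x′ (trans x′≈y′ (sym y≈y′)))) ,
    trans (*-cong x-y≈x′-y′ x-y≈x′-y′) [x-y]²≈1
    where x-y≈x′-y′ = +-cong (sym x≈x′) (-‿cong (sym y≈y′))

  ≈-by-differences : ∀ {x y x′ y′} → x - y ≈ x′ - y′ → x ≈ y → x′ ≈ y′
  ≈-by-differences {x′ = x′} {y′} x-y≈x′-y′ x≈y = x∙y⁻¹≈ε⇒x≈y x′ y′ (trans (sym x-y≈x′-y′) (x≈y⇒x∙y⁻¹≈ε x≈y))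

  x-0≈x : ∀ x → x - 0# ≈ x
  x-0≈x x = trans (+-cong refl ε⁻¹≈ε) (+-identityʳ x)

  -x*-y≈x*y : ∀ x y → - x * - y ≈ x * y
  -x*-y≈x*y x y = begin
    - x * - y      ≈⟨ -‿distribˡ-* x (- y) ⟨
    - (x * - y)    ≈⟨ -‿cong (-‿distribʳ-* x y) ⟨
    - (- (x * y))  ≈⟨ ⁻¹-involutive (x * y) ⟩
    x * y          ∎

  [x-y]²≈[y-x]² : ∀ x y → (x - y) * (x - y) ≈ (y - x) * (y - x)
  [x-y]²≈[y-x]² x y = begin
    (x - y) * (x - y)          ≈⟨ *-cong (⁻¹-anti-homo‿- y x) (⁻¹-anti-homo‿- y x) ⟨
    - (y - x) * - (y - x)      ≈⟨ -x*-y≈x*y (y - x) (y - x) ⟩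
    (y - x) * (y - x)          ∎

  [z-x]+[y-z]≈y-x : ∀ x y z → (z - x) + (y - z) ≈ y - x
  [z-x]+[y-z]≈y-x x y z = begin
    (z - x) + (y - z)          ≈⟨ +-comm (z - x) (y - z) ⟩
    (y - z) + (z - x)          ≈⟨ +-assoc y (- z) (z - x) ⟩
    y + (- z + (z - x))        ≈⟨ +-cong refl (\\-leftDividesʳ z (- x)) ⟩
    y - x                      ∎

  Reachable⇒SumOfInvolutions : ∀ {x y} → Reachable R x y → SumOfInvolutions (y - x)
  Reachable⇒SumOfInvolutions (here x≈y) = [] , [] , x≈y⇒x∙y⁻¹≈ε (sym x≈y)
  Reachable⇒SumOfInvolutions {x} {y} (step {y = z} (_ , [x-z]²≈1) z⇝y)
    with us , involutions , y-z≈Σus ← Reachable⇒SumOfInvolutions z⇝y =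
    (z - x) ∷ us , trans (sym ([x-y]²≈[y-x]² x z)) [x-z]²≈1 ∷ involutions ,
    trans (sym ([z-x]+[y-z]≈y-x x y z)) (+-cong refl y-z≈Σus)

  module _ (1≉0 : ¬ 1# ≈ 0#) where

    Adj⇔Involution : ∀ {x y} → Adj R x y ⇔ Involution (y - x)
    Adj⇔Involution {x} {y} = mk⇔
      (λ (_ , [x-y]²≈1) → trans (sym ([x-y]²≈[y-x]² x y)) [x-y]²≈1)
      (λ [y-x]²≈1 → (λ x≈y → 1≉0 (trans (sym [y-x]²≈1) (square≈0 (x≈y⇒x∙y⁻¹≈ε (sym x≈y)))))
                  , trans ([x-y]²≈[y-x]² x y) [y-x]²≈1)
      where
      square≈0 : ∀ {z} → z ≈ 0# → z * z ≈ 0#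
      square≈0 z≈0 = trans (*-cong z≈0 refl) (zeroˡ _)

    Adj-0⇔Involution : ∀ {u} → Adj R 0# u ⇔ Involution u
    Adj-0⇔Involution {u} = mk⇔
      (λ 0~u → Involution-resp-≈ (x-0≈x u) (Equivalence.to Adj⇔Involution 0~u))
      (λ u²≈1 → Equivalence.from Adj⇔Involution (Involution-resp-≈ (sym (x-0≈x u)) u²≈1))

    Adj-+ : ∀ {u} x → Involution u → Adj R x (u + x)
    Adj-+ {u} x u²≈1 = Equivalence.from Adj⇔Involution (Involution-resp-≈ (sym (//-rightDividesʳ x u)) u²≈1)

    SumOfInvolutions⇒Reachable : ∀ {us} → All Involution us → ∀ {x y} → y ≈ sum us + x → Reachable R x y
    SumOfInvolutions⇒Reachable [] {x} y≈0+x = here (sym (trans y≈0+x (+-identityˡ x)))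
    SumOfInvolutions⇒Reachable {u ∷ us} (u²≈1 ∷ involutions) {x} {y} y≈Σ+x =
      step (Adj-+ x u²≈1) (SumOfInvolutions⇒Reachable involutions (begin
        y                    ≈⟨ y≈Σ+x ⟩
        (u + sum us) + x     ≈⟨ +-cong (+-comm u (sum us)) refl ⟩
        (sum us + u) + x     ≈⟨ +-assoc (sum us) u x ⟩
        sum us + (u + x)     ∎))

    Connected⇔SumsOfInvolutions : Connected R ⇔ (∀ x → SumOfInvolutions x)
    Connected⇔SumsOfInvolutions = mk⇔
      (λ connected x → let us , involutions , x-0≈Σus = Reachable⇒SumOfInvolutions (connected 0# x)
                       in us , involutions , trans (sym (x-0≈x x)) x-0≈Σus)
      (λ sums x y → let us , involutions , y-x≈Σus = sums (y - x)
                    in SumOfInvolutions⇒Reachable involutions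
                         (trans (sym (//-rightDividesˡ x y)) (+-cong y-x≈Σus refl)))

    HasDegree-0⇒Regular : ∀ {d} → HasDegree R 0# d → Regular R d
    HasDegree-0⇒Regular (v , v-injective , 0~v , v-covers) x =
      (λ i → v i + x)
      , (λ i j vᵢ+x≈vⱼ+x → v-injective i j (∙-cancelʳ x (v i) (v j) vᵢ+x≈vⱼ+x))
      , (λ i → Adj-+ x (Equivalence.to Adj-0⇔Involution (0~v i)))
      , λ y x~y → let i , y-x≈vᵢ = v-covers (y - x) (Equivalence.from Adj-0⇔Involution (Equivalence.to Adj⇔Involution x~y))
                  in i , trans (sym (//-rightDividesˡ x y)) (+-cong y-x≈vᵢ refl)

  module Degree4 {x : Carrier} (deg : HasDegree R x 4) where
    private
      v : Fin 4 → Carrier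
      v = proj₁ deg

      v-injective : ∀ i j → v i ≈ v j → i ≡ j
      v-injective = proj₁ (proj₂ deg)

      x~v : ∀ i → Adj R x (v i)
      x~v = proj₁ (proj₂ (proj₂ deg))

      index : ∀ {y} → Adj R x y → Fin 4
      index x~y = proj₁ (proj₂ (proj₂ (proj₂ deg)) _ x~y)

      ≈v-index : ∀ {y} (x~y : Adj R x y) → y ≈ v (index x~y)
      ≈v-index x~y = proj₂ (proj₂ (proj₂ (proj₂ deg)) _ x~y)

      same-index : ∀ {a b} (x~a : Adj R x a) (x~b : Adj R x b) → index x~a ≡ index x~b → a ≈ b
      same-index x~a x~b i≡j = trans (≈v-index x~a) (trans (reflexive (cong v i≡j)) (sym (≈v-index x~b)))

      fin4-avoid : (i j : Fin 4) → ∃ λ k → k ≢ i × k ≢ j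
      fin4-avoid = from-yes (all? λ (i : Fin 4) → all? λ (j : Fin 4) → any? λ (k : Fin 4) → ¬? (k ≟ i) ×-dec ¬? (k ≟ j))

      fin4-exhausted : (i j k l : Fin 4) → i ≢ j → i ≢ k → i ≢ l → j ≢ k → j ≢ l → k ≢ l →
                       ∀ m → m ≡ i ⊎ m ≡ j ⊎ m ≡ k ⊎ m ≡ l
      fin4-exhausted = from-yes (all? λ (i : Fin 4) → all? λ (j : Fin 4) → all? λ (k : Fin 4) → all? λ (l : Fin 4) →
        ¬? (i ≟ j) →-dec ¬? (i ≟ k) →-dec ¬? (i ≟ l) →-dec ¬? (j ≟ k) →-dec ¬? (j ≟ l) →-dec ¬? (k ≟ l) →-dec
        all? λ (m : Fin 4) → (m ≟ i) ⊎-dec (m ≟ j) ⊎-dec (m ≟ k) ⊎-dec (m ≟ l))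

    fresh-neighbour : ∀ {a b} → Adj R x a → Adj R x b → ∃ λ y → Adj R x y × ¬ y ≈ a × ¬ y ≈ b
    fresh-neighbour x~a x~b =
      let k , k≢a , k≢b = fin4-avoid (index x~a) (index x~b)
      in v k , x~v k
         , (λ vₖ≈a → k≢a (v-injective k _ (trans vₖ≈a (≈v-index x~a))))
         , (λ vₖ≈b → k≢b (v-injective k _ (trans vₖ≈b (≈v-index x~b))))

    four-neighbours-exhaust : ∀ {a b c d y} (x~a : Adj R x a) (x~b : Adj R x b) (x~c : Adj R x c) (x~d : Adj R x d) →
      ¬ a ≈ b → ¬ a ≈ c → ¬ a ≈ d → ¬ b ≈ c → ¬ b ≈ d → ¬ c ≈ d →
      Adj R x y → y ≈ a ⊎ y ≈ b ⊎ y ≈ c ⊎ y ≈ d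
    four-neighbours-exhaust x~a x~b x~c x~d a≉b a≉c a≉d b≉c b≉d c≉d x~y =
      Sum.map (same-index x~y x~a) (Sum.map (same-index x~y x~b) (Sum.map (same-index x~y x~c) (same-index x~y x~d)))
        (fin4-exhausted _ _ _ _ (distinct x~a x~b a≉b) (distinct x~a x~c a≉c) (distinct x~a x~d a≉d)
                                (distinct x~b x~c b≉c) (distinct x~b x~d b≉d) (distinct x~c x~d c≉d) (index x~y))
      where
      distinct : ∀ {a b} (x~a : Adj R x a) (x~b : Adj R x b) → ¬ a ≈ b → index x~a ≢ index x~b
      distinct x~a x~b a≉b i≡j = a≉b (same-index x~a x~b i≡j)

module _ {c₁ ℓ₁ c₂ ℓ₂} (R : CommutativeRing c₁ ℓ₁) (S : CommutativeRing c₂ ℓ₂)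
         {f : CommutativeRing.Carrier R → CommutativeRing.Carrier S}
         (iso : RingMorphisms.IsRingIsomorphism (CommutativeRing.rawRing R) (CommutativeRing.rawRing S) f) where
  private
    module R = CommutativeRing R
    module S = CommutativeRing S
  open RingMorphisms.IsRingIsomorphism iso

  private
    f-square-difference : ∀ x y → f ((x R.- y) R.* (x R.- y)) S.≈ (f x S.- f y) S.* (f x S.- f y)
    f-square-difference x y = S.trans (*-homo _ _) (S.*-cong f[x-y] f[x-y])
      where f[x-y] = S.trans (+-homo x (R.- y)) (S.+-cong S.refl (-‿homo y))

    preimage : S.Carrier → R.Carrier
    preimage s = proj₁ (surjective s)

    f-preimage : ∀ s → f (preimage s) S.≈ s
    f-preimage s = proj₂ (surjective s) R.refl

  Adj-preserve : ∀ {x y} → Adj R x y → Adj S (f x) (f y)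
  Adj-preserve {x} {y} (x≉y , [x-y]²≈1) =
    (λ fx≈fy → x≉y (injective fx≈fy)) ,
    S.trans (S.sym (f-square-difference x y)) (S.trans (⟦⟧-cong [x-y]²≈1) 1#-homo)

  Adj-reflect : ∀ {x y} → Adj S (f x) (f y) → Adj R x y
  Adj-reflect {x} {y} (fx≉fy , [fx-fy]²≈1) =
    (λ x≈y → fx≉fy (⟦⟧-cong x≈y)) ,
    injective (S.trans (f-square-difference x y) (S.trans [fx-fy]²≈1 (S.sym 1#-homo)))

  Reachable-reflect : ∀ {p q} → Reachable S p q → ∀ {x y} → f x S.≈ p → f y S.≈ q → Reachable R x y
  Reachable-reflect (here p≈q) fx≈p fy≈q = here (injective (S.trans fx≈p (S.trans p≈q (S.sym fy≈q))))
  Reachable-reflect (step {y = s} p~s s⇝q) fx≈p fy≈q =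
    step (Adj-reflect (Adj-resp-≈ S (S.sym fx≈p) (S.sym (f-preimage s)) p~s))
         (Reachable-reflect s⇝q (f-preimage s) fy≈q)

  Connected-reflect : Connected S → Connected R
  Connected-reflect connected x y = Reachable-reflect (connected (f x) (f y)) S.refl S.refl

  Regular-reflect : ∀ {d} → Regular S d → Regular R d
  Regular-reflect regular x =
    let v , v-injective , fx~v , v-covers = regular (f x)
    in (λ i → preimage (v i))
       , (λ i j wᵢ≈wⱼ → v-injective i j (S.trans (S.sym (f-preimage (v i))) (S.trans (⟦⟧-cong wᵢ≈wⱼ) (f-preimage (v j)))))
       , (λ i → Adj-reflect (Adj-resp-≈ S S.refl (S.sym (f-preimage (v i))) (fx~v i)))
       , λ y x~y → let i , fy≈vᵢ = v-covers (f y) (Adj-preserve x~y)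
                   in i , injective (S.trans fy≈vᵢ (S.sym (f-preimage (v i))))

module _ {c₁ ℓ₁ c₂ ℓ₂} (R : CommutativeRing c₁ ℓ₁) (S : CommutativeRing c₂ ℓ₂)
         {ψ : CommutativeRing.Carrier S → CommutativeRing.Carrier R}
         (ψ-mono : RingMorphisms.IsRingMonomorphism (CommutativeRing.rawRing S) (CommutativeRing.rawRing R) ψ)
         {φ : CommutativeRing.Carrier R → CommutativeRing.Carrier S}
         (ψ∘φ≈id : ∀ x → CommutativeRing._≈_ R (ψ (φ x)) x) where
  private
    module R = CommutativeRing R
    module S = CommutativeRing S
  open RingMorphisms.IsRingMonomorphism ψ-mono

  private
    φ-unique : ∀ {x p} → x R.≈ ψ p → φ x S.≈ p
    φ-unique x≈ψp = injective (R.trans (ψ∘φ≈id _) x≈ψp)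

    ψ∘φ-resp : ∀ {x y} → x R.≈ y → x R.≈ ψ (φ y)
    ψ∘φ-resp x≈y = R.trans x≈y (R.sym (ψ∘φ≈id _))

  section-isRingIsomorphism : RingMorphisms.IsRingIsomorphism R.rawRing S.rawRing φ
  section-isRingIsomorphism = record
    { isRingMonomorphism = record
      { isRingHomomorphism = record
        { isSemiringHomomorphism = record
          { isNearSemiringHomomorphism = record
            { +-isMonoidHomomorphism = record
              { isMagmaHomomorphism = record
                { isRelHomomorphism = record { cong = λ x≈y → φ-unique (ψ∘φ-resp x≈y) }
                ; homo = λ x y → φ-unique (R.trans (R.+-cong (ψ∘φ-resp R.refl) (ψ∘φ-resp R.refl)) (R.sym (+-homo _ _)))
                }
              ; ε-homo = φ-unique (R.sym 0#-homo)
              }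
            ; *-homo = λ x y → φ-unique (R.trans (R.*-cong (ψ∘φ-resp R.refl) (ψ∘φ-resp R.refl)) (R.sym (*-homo _ _)))
            }
          ; 1#-homo = φ-unique (R.sym 1#-homo)
          }
        ; -‿homo = λ x → φ-unique (R.trans (R.-‿cong (ψ∘φ-resp R.refl)) (R.sym (-‿homo _)))
        }
      ; injective = λ {x} {y} φx≈φy → R.trans (R.sym (ψ∘φ≈id x)) (R.trans (⟦⟧-cong φx≈φy) (ψ∘φ≈id y))
      }
    ; surjective = λ p → ψ p , φ-unique
    }

module _ (M : Monoid c ℓ) where
  open Monoid M
  open MonoidMultProperties M renaming (_×_ to _·_)
  open SetoidReasoning setoid

  ×-ε : ∀ n → n · ε ≈ ε
  ×-ε zero    = refl
  ×-ε (suc n) = trans (∙-cong refl (×-ε n)) (identityˡ ε)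

  ×-mod : ∀ d .{{_ : NonZero d}} {x} → d · x ≈ ε → ∀ k → toℕ (k mod d) · x ≈ k · x
  ×-mod d {x} d·x≈ε k = begin
    toℕ (k mod d) · x                 ≡⟨ cong (_· x) (toℕ-fromℕ< (m%n<n k d)) ⟩
    (k % d) · x                       ≈⟨ identityʳ _ ⟨
    (k % d) · x ∙ ε                   ≈⟨ ∙-cong refl multiple-of-d≈ε ⟨
    (k % d) · x ∙ ((k / d) *ℕ d) · x  ≈⟨ ×-homo-+ x (k % d) _ ⟨
    (k % d +ℕ (k / d) *ℕ d) · x       ≡⟨ cong (_· x) (m≡m%n+[m/n]*n k d) ⟨
    k · x                             ∎
    where
    multiple-of-d≈ε : ((k / d) *ℕ d) · x ≈ ε
    multiple-of-d≈ε = trans (sym (×-assocˡ x (k / d) d)) (trans (×-congʳ (k / d) d·x≈ε) (×-ε (k / d)))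

module _ where
  open RawRing Z4x

  private
    _≟Z_ : (p q : Carrier) → Dec (p ≡ q)
    _≟Z_ = ≡-dec _≟_ _≟_

    allZ? : ∀ {p} {P : Carrier → Set p} → (∀ x → Dec (P x)) → Dec (∀ x → P x)
    allZ? P? = map′ (λ ∀P x → ∀P (proj₁ x) (proj₂ x)) (λ ∀P a b → ∀P (a , b)) (all? λ a → all? λ b → P? (a , b))

  Z4x-isCommutativeRing : IsCommutativeRing _≡_ _+_ _*_ -_ 0# 1#
  Z4x-isCommutativeRing = record
    { isRing = record
      { +-isAbelianGroup = record
        { isGroup = record
          { isMonoid = record
            { isSemigroup = record
              { isMagma = record { isEquivalence = ≡.isEquivalence ; ∙-cong = cong₂ _+_ }
              ; assoc = from-yes (allZ? λ x → allZ? λ y → allZ? λ z → ((x + y) + z) ≟Z (x + (y + z)))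
              }
            ; identity = from-yes (allZ? λ x → (0# + x) ≟Z x) , from-yes (allZ? λ x → (x + 0#) ≟Z x)
            }
          ; inverse = from-yes (allZ? λ x → (- x + x) ≟Z 0#) , from-yes (allZ? λ x → (x + - x) ≟Z 0#)
          ; ⁻¹-cong = cong -_
          }
        ; comm = from-yes (allZ? λ x → allZ? λ y → (x + y) ≟Z (y + x))
        }
      ; *-cong = cong₂ _*_
      ; *-assoc = from-yes (allZ? λ x → allZ? λ y → allZ? λ z → ((x * y) * z) ≟Z (x * (y * z)))
      ; *-identity = from-yes (allZ? λ x → (1# * x) ≟Z x) , from-yes (allZ? λ x → (x * 1#) ≟Z x)
      ; distrib = from-yes (allZ? λ x → allZ? λ y → allZ? λ z → (x * (y + z)) ≟Z ((x * y) + (x * z)))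
                , from-yes (allZ? λ x → allZ? λ y → allZ? λ z → ((y + z) * x) ≟Z ((y * x) + (z * x)))
      }
    ; *-comm = from-yes (allZ? λ x → allZ? λ y → (x * y) ≟Z (y * x))
    }

  Z4x-commutativeRing : CommutativeRing 0ℓ 0ℓ
  Z4x-commutativeRing = record { isCommutativeRing = Z4x-isCommutativeRing }

  private
    1≢0 : ¬ 1# ≡ 0#
    1≢0 ()

    Adj? : ∀ p q → Dec (Adj Z4x-commutativeRing p q)
    Adj? p q = ¬? (p ≟Z q) ×-dec (((p + - q) * (p + - q)) ≟Z 1#)

    x : Carrier
    x = # 0 , # 1

    involution : Fin 4 → Carrier
    involution fzero                      = 1#
    involution (fsuc fzero)               = - 1#
    involution (fsuc (fsuc fzero))        = 1# + x
    involution (fsuc (fsuc (fsuc fzero))) = - 1# + x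

    decomposition : Carrier → List Carrier
    decomposition (n , b) = replicate (toℕ n) 1# ++ replicate (toℕ b) (1# + x) ++ replicate (toℕ b) (- 1#)

  Z4x-sumsOfInvolutions : ∀ p → SumOfInvolutions Z4x-commutativeRing p
  Z4x-sumsOfInvolutions p = decomposition p , decomposition-correct p
    where
    decomposition-correct = from-yes (allZ? λ p →
      All.all? (λ u → (u * u) ≟Z 1#) (decomposition p) ×-dec (p ≟Z sum Z4x-commutativeRing (decomposition p)))

  Z4x-hasDegree-0 : HasDegree Z4x-commutativeRing 0# 4
  Z4x-hasDegree-0 =
    involution ,
    from-yes (all? λ i → all? λ j → (involution i ≟Z involution j) →-dec (i ≟ j)) ,
    from-yes (all? λ i → Adj? 0# (involution i)) ,
    from-yes (allZ? λ y → Adj? 0# y →-dec any? λ i → y ≟Z involution i)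

  Z4x-connected : Connected Z4x-commutativeRing
  Z4x-connected = Equivalence.from (Connected⇔SumsOfInvolutions Z4x-commutativeRing 1≢0) Z4x-sumsOfInvolutions

  Z4x-regular : Regular Z4x-commutativeRing 4
  Z4x-regular = HasDegree-0⇒Regular Z4x-commutativeRing 1≢0 Z4x-hasDegree-0

ℤ/4 : RawRing 0ℓ 0ℓ
ℤ/4 = record
  { Carrier = Fin 4
  ; _≈_ = _≡_
  ; _+_ = λ a b → (toℕ a +ℕ toℕ b) mod 4
  ; _*_ = λ a b → (toℕ a *ℕ toℕ b) mod 4
  ; -_ = λ a → (3 *ℕ toℕ a) mod 4
  ; 0# = # 0
  ; 1# = # 1
  }

module ℤ/4-Algebra (R : CommutativeRing c ℓ)
  (4·1≈0 : CommutativeRing._≈_ R (natMul R 4 (CommutativeRing.1# R)) (CommutativeRing.0# R)) where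
  open CommutativeRing R
  open SemiringMultProperties semiring using (×-homo-+; ×-assocˡ; ×-assoc-*; ×-congʳ; ×1-homo-*) renaming (_×_ to _·_)
  open GroupProperties +-group using (inverseˡ-unique)
  open CommutativeSemigroupProperties +-commutativeSemigroup using (interchange)
  open SetoidReasoning setoid

  -- Defined by cases so that the solver's constants 0 and 1 are 0# and 1# on the nose.
  ι : Fin 4 → Carrier
  ι fzero        = 0#
  ι (fsuc fzero) = 1#
  ι k            = toℕ k · 1#

  ι≈·1 : ∀ k → ι k ≈ toℕ k · 1#
  ι≈·1 fzero               = refl
  ι≈·1 (fsuc fzero)        = sym (+-identityʳ 1#)
  ι≈·1 (fsuc (fsuc fzero)) = refl
  ι≈·1 (fsuc (fsuc (fsuc fzero))) = refl

  ι-mod : ∀ k → ι (k mod 4) ≈ k · 1#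
  ι-mod k = trans (ι≈·1 (k mod 4)) (×-mod +-monoid 4 4·1≈0 k)

  ι-homomorphism : ℤ/4 -Raw-AlmostCommutative⟶ fromCommutativeRing R
  ι-homomorphism = record
    { ⟦_⟧ = ι
    ; +-homo = λ a b → trans (ι-mod (toℕ a +ℕ toℕ b))
                         (trans (×-homo-+ 1# (toℕ a) (toℕ b)) (sym (+-cong (ι≈·1 a) (ι≈·1 b))))
    ; *-homo = λ a b → trans (ι-mod (toℕ a *ℕ toℕ b))
                         (trans (×1-homo-* (toℕ a) (toℕ b)) (sym (*-cong (ι≈·1 a) (ι≈·1 b))))
    ; -‿homo = λ a → trans (inverseˡ-unique _ _ (trans (+-cong (ι-mod (3 *ℕ toℕ a)) refl) (three-a+a≈0 (toℕ a))))
                         (-‿cong (sym (ι≈·1 a)))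
    ; 0-homo = refl
    ; 1-homo = refl
    }
    where
    three-a+a≈0 : ∀ a → (3 *ℕ a) · 1# + a · 1# ≈ 0#
    three-a+a≈0 a = begin
      (3 *ℕ a) · 1# + a · 1#   ≈⟨ ×-homo-+ 1# (3 *ℕ a) a ⟨
      (3 *ℕ a +ℕ a) · 1#       ≡⟨ cong (_· 1#) (≡.trans (ℕ.+-comm (3 *ℕ a) a) (ℕ.*-comm 4 a)) ⟩
      (a *ℕ 4) · 1#            ≈⟨ ×-assocˡ 1# a 4 ⟨
      a · (4 · 1#)             ≈⟨ ×-congʳ a 4·1≈0 ⟩
      a · 0#                   ≈⟨ ×-ε +-monoid a ⟩
      0#                       ∎

  -- With coefficients in ℤ/4 the solver's normal forms already know that 4 = 0.
  open RingSolver ℤ/4 (fromCommutativeRing R) ι-homomorphism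
    (λ a b → Maybe.map (λ a≡b → reflexive (cong ι a≡b)) (dec⇒maybe (a ≟ b))) public

  𝟎 𝟏 𝟐 𝟑 : ∀ {n} → Polynomial n
  𝟎 = con (# 0)
  𝟏 = con (# 1)
  𝟐 = con (# 2)
  𝟑 = con (# 3)

  module Evaluation {a} (2·a≈0 : natMul R 2 a ≈ 0#) (a²≈0 : a * a ≈ 0#) where
    private
      module Z = CommutativeRing Z4x-commutativeRing
    open _-Raw-AlmostCommutative⟶_ ι-homomorphism using () renaming (+-homo to ι-+; *-homo to ι-*)

    evaluate : Z.Carrier → Carrier
    evaluate (n , b) = ι n + toℕ b · a

    evaluate-+ : ∀ p q → evaluate (p Z.+ q) ≈ evaluate p + evaluate q
    evaluate-+ (n , b) (n′ , d) = begin
      ι ((toℕ n +ℕ toℕ n′) mod 4) + toℕ ((toℕ b +ℕ toℕ d) mod 2) · a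
        ≈⟨ +-cong (ι-+ n n′) (×-mod +-monoid 2 2·a≈0 (toℕ b +ℕ toℕ d)) ⟩
      (ι n + ι n′) + (toℕ b +ℕ toℕ d) · a
        ≈⟨ +-cong refl (×-homo-+ a (toℕ b) (toℕ d)) ⟩
      (ι n + ι n′) + (toℕ b · a + toℕ d · a)
        ≈⟨ interchange (ι n) (ι n′) (toℕ b · a) (toℕ d · a) ⟩
      (ι n + toℕ b · a) + (ι n′ + toℕ d · a) ∎

    evaluate-* : ∀ p q → evaluate (p Z.* q) ≈ evaluate p * evaluate q
    evaluate-* (n , b) (n′ , d) = begin
      ι ((N *ℕ N′) mod 4) + toℕ ((N *ℕ D +ℕ B *ℕ N′) mod 2) · a
        ≈⟨ +-cong (ι-* n n′) (trans (×-mod +-monoid 2 2·a≈0 (N *ℕ D +ℕ B *ℕ N′)) (·-as-* (N *ℕ D +ℕ B *ℕ N′))) ⟩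
      x * z + ((N *ℕ D +ℕ B *ℕ N′) · 1#) * a
        ≈⟨ +-cong refl (*-cong cross-terms refl) ⟩
      x * z + (x * w + y * z) * a
        ≈⟨ +-identityʳ _ ⟨
      x * z + (x * w + y * z) * a + 0#
        ≈⟨ +-cong refl (trans (*-cong refl a²≈0) (zeroʳ (y * w))) ⟨
      x * z + (x * w + y * z) * a + (y * w) * (a * a)
        ≈⟨ solve 5 (λ x y z w a → x :* z :+ (x :* w :+ y :* z) :* a :+ (y :* w) :* (a :* a)
                                  := (x :+ y :* a) :* (z :+ w :* a)) refl x y z w a ⟩
      (x + y * a) * (z + w * a)
        ≈⟨ *-cong (+-cong refl (·-as-* B)) (+-cong refl (·-as-* D)) ⟨
      (x + B · a) * (z + D · a) ∎
      where
      N = toℕ n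
      B = toℕ b
      N′ = toℕ n′
      D = toℕ d
      x = ι n
      y = B · 1#
      z = ι n′
      w = D · 1#
      ·-as-* : ∀ k → k · a ≈ (k · 1#) * a
      ·-as-* k = sym (trans (×-assoc-* k 1# a) (×-congʳ k (*-identityˡ a)))
      cross-terms : (N *ℕ D +ℕ B *ℕ N′) · 1# ≈ x * w + y * z
      cross-terms = begin
        (N *ℕ D +ℕ B *ℕ N′) · 1#            ≈⟨ ×-homo-+ 1# (N *ℕ D) (B *ℕ N′) ⟩
        (N *ℕ D) · 1# + (B *ℕ N′) · 1#      ≈⟨ +-cong (×1-homo-* N D) (×1-homo-* B N′) ⟩
        (N · 1#) * w + y * (N′ · 1#)        ≈⟨ +-cong (*-cong (ι≈·1 n) refl) (*-cong refl (ι≈·1 n′)) ⟨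
        x * w + y * z                       ∎

    evaluate-0 : evaluate Z.0# ≈ 0#
    evaluate-0 = +-identityʳ 0#

    evaluate-negate : ∀ p → evaluate (Z.- p) ≈ - evaluate p
    evaluate-negate p = inverseˡ-unique (evaluate (Z.- p)) (evaluate p)
      (trans (sym (evaluate-+ (Z.- p) p)) (trans (reflexive (cong evaluate (Z.-‿inverseˡ p))) evaluate-0))

    evaluate-isRingHomomorphism : RingMorphisms.IsRingHomomorphism Z.rawRing rawRing evaluate
    evaluate-isRingHomomorphism = record
      { isSemiringHomomorphism = record
        { isNearSemiringHomomorphism = record
          { +-isMonoidHomomorphism = record
            { isMagmaHomomorphism = record
              { isRelHomomorphism = record { cong = λ p≡q → reflexive (cong evaluate p≡q) }
              ; homo = evaluate-+
              }
            ; ε-homo = evaluate-0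
            }
          ; *-homo = evaluate-*
          }
        ; 1#-homo = +-identityʳ 1#
        }
      ; -‿homo = evaluate-negate
      }

module Recognition (R : CommutativeRing c ℓ) (char4 : HasCharacteristic R 4)
                 (connected : Connected R) (regular : Regular R 4) where
  open CommutativeRing R
  open ℤ/4-Algebra R (proj₁ (proj₂ char4))
  open Degree4 R (regular 0#)
  open GroupProperties +-group using (x∙y⁻¹≈ε⇒x≈y; x≈y⇒x∙y⁻¹≈ε; inverseˡ-unique)
  open SetoidReasoning setoid
  private
    module Z = CommutativeRing Z4x-commutativeRing

  1≉0 : ¬ 1# ≈ 0#
  1≉0 1≈0 = proj₂ (proj₂ char4) 1 z<s (s<s z<s) (trans (+-identityʳ 1#) 1≈0)

  2≉0 : ¬ ι (# 2) ≈ 0#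
  2≉0 = proj₂ (proj₂ char4) 2 z<s (s<s (s<s z<s))

  3≉0 : ¬ ι (# 3) ≈ 0#
  3≉0 = proj₂ (proj₂ char4) 3 z<s (s<s (s<s (s<s z<s)))

  neighbour : ∀ {u} → Involution R u → Adj R 0# u
  neighbour = Equivalence.from (Adj-0⇔Involution R 1≉0)

  sums : ∀ x → SumOfInvolutions R x
  sums = Equivalence.to (Connected⇔SumsOfInvolutions R 1≉0) connected

  1²≈1 : Involution R 1#
  1²≈1 = *-identityˡ 1#

  -1²≈1 : Involution R (- 1#)
  -1²≈1 = solve 0 ((:- 𝟏) :* (:- 𝟏) := 𝟏) refl

  1≉-1 : ¬ 1# ≈ - 1#
  1≉-1 1≈-1 = 2≉0 (≈-by-differences R (solve 0 (𝟏 :- (:- 𝟏) := 𝟐 :- 𝟎) refl) 1≈-1)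

  module _ {u} (u²≈1 : Involution R u) (u≉1 : ¬ u ≈ 1#) (u≉-1 : ¬ u ≈ - 1#) where
    u≉0 : ¬ u ≈ 0#
    u≉0 u≈0 = 1≉0 (trans (sym u²≈1) (trans (*-cong u≈0 refl) (zeroˡ u)))

    u≉-u : ¬ u ≈ - u
    u≉-u u≈-u = 1≉-1 (begin
      1#          ≈⟨ u²≈1 ⟨
      u * u       ≈⟨ *-cong u≈-u refl ⟩
      - u * u     ≈⟨ solve 1 (λ u → (:- u) :* u := :- (u :* u)) refl u ⟩
      - (u * u)   ≈⟨ -‿cong u²≈1 ⟩
      - 1#        ∎)

    -u²≈1 : Involution R (- u)
    -u²≈1 = trans (solve 1 (λ u → (:- u) :* (:- u) := u :* u) refl u) u²≈1
    [u+2]²≈1 : Involution R (u + ι (# 2))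
    [u+2]²≈1 = trans (solve 1 (λ u → (u :+ 𝟐) :* (u :+ 𝟐) := u :* u) refl u) u²≈1
    1≉-u : ¬ 1# ≈ - u
    1≉-u 1≈-u = u≉-1 (≈-by-differences R (solve 1 (λ u → 𝟏 :- (:- u) := u :- (:- 𝟏)) refl u) 1≈-u)
    -1≉-u : ¬ - 1# ≈ - u
    -1≉-u -1≈-u = u≉1 (≈-by-differences R (solve 1 (λ u → (:- 𝟏) :- (:- u) := u :- 𝟏) refl u) -1≈-u)

    involutions-exhausted : ∀ {w} → Involution R w → w ≈ 1# ⊎ w ≈ - 1# ⊎ w ≈ u ⊎ w ≈ - u
    involutions-exhausted w²≈1 =
      four-neighbours-exhaust (neighbour 1²≈1) (neighbour -1²≈1) (neighbour u²≈1) (neighbour -u²≈1)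
        1≉-1 (u≉1 ∘ sym) 1≉-u (u≉-1 ∘ sym) -1≉-u u≉-u (neighbour w²≈1)

    -u≈u+2 : - u ≈ u + ι (# 2)
    -u≈u+2 = exclude (involutions-exhausted [u+2]²≈1)
      where
      exclude : u + ι (# 2) ≈ 1# ⊎ u + ι (# 2) ≈ - 1# ⊎ u + ι (# 2) ≈ u ⊎ u + ι (# 2) ≈ - u → - u ≈ u + ι (# 2)
      exclude (inj₁ u+2≈1) = ⊥-elim (u≉-1 (≈-by-differences R (solve 1 (λ u → (u :+ 𝟐) :- 𝟏 := u :- (:- 𝟏)) refl u) u+2≈1))
      exclude (inj₂ (inj₁ u+2≈-1)) = ⊥-elim (u≉1 (≈-by-differences R (solve 1 (λ u → (u :+ 𝟐) :- (:- 𝟏) := u :- 𝟏) refl u) u+2≈-1))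
      exclude (inj₂ (inj₂ (inj₁ u+2≈u))) = ⊥-elim (2≉0 (≈-by-differences R (solve 1 (λ u → (u :+ 𝟐) :- u := 𝟐 :- 𝟎) refl u) u+2≈u))
      exclude (inj₂ (inj₂ (inj₂ u+2≈-u))) = sym u+2≈-u

    a : Carrier
    a = u - 1#

    2·a≈0 : natMul R 2 a ≈ 0#
    2·a≈0 = ≈-by-differences R (solve 1 (λ u → (:- u) :- (u :+ 𝟐) := ((u :- 𝟏) :+ ((u :- 𝟏) :+ 𝟎)) :- 𝟎) refl u) -u≈u+2

    a²≈0 : a * a ≈ 0#
    a²≈0 = begin
      a * a                 ≈⟨ solve 1 (λ u → (u :- 𝟏) :* (u :- 𝟏) := (u :* u :- 𝟏) :- ((u :- 𝟏) :+ ((u :- 𝟏) :+ 𝟎))) refl u ⟩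
      (u * u - 1#) - natMul R 2 a ≈⟨ +-cong (x≈y⇒x∙y⁻¹≈ε u²≈1) (-‿cong 2·a≈0) ⟩
      0# - 0#               ≈⟨ -‿inverseʳ 0# ⟩
      0#                    ∎

    open Evaluation 2·a≈0 a²≈0

    evaluate-kernel : ∀ p → evaluate p ≈ 0# → p ≡ Z.0#
    evaluate-kernel (fzero , fzero) _ = ≡.refl
    evaluate-kernel (fsuc fzero , fzero) eval≈0 = ⊥-elim (1≉0 (trans (sym (+-identityʳ 1#)) eval≈0))
    evaluate-kernel (fsuc (fsuc fzero) , fzero) eval≈0 = ⊥-elim (2≉0 (trans (sym (+-identityʳ _)) eval≈0))
    evaluate-kernel (fsuc (fsuc (fsuc fzero)) , fzero) eval≈0 = ⊥-elim (3≉0 (trans (sym (+-identityʳ _)) eval≈0))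
    evaluate-kernel (fzero , fsuc fzero) eval≈0 =
      ⊥-elim (u≉1 (≈-by-differences R (solve 1 (λ u → (𝟎 :+ ((u :- 𝟏) :+ 𝟎)) :- 𝟎 := u :- 𝟏) refl u) eval≈0))
    evaluate-kernel (fsuc fzero , fsuc fzero) eval≈0 =
      ⊥-elim (u≉0 (≈-by-differences R (solve 1 (λ u → (𝟏 :+ ((u :- 𝟏) :+ 𝟎)) :- 𝟎 := u :- 𝟎) refl u) eval≈0))
    evaluate-kernel (fsuc (fsuc fzero) , fsuc fzero) eval≈0 =
      ⊥-elim (u≉-1 (≈-by-differences R (solve 1 (λ u → (𝟐 :+ ((u :- 𝟏) :+ 𝟎)) :- 𝟎 := u :- (:- 𝟏)) refl u) eval≈0))
    evaluate-kernel (fsuc (fsuc (fsuc fzero)) , fsuc fzero) eval≈0 =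
      ⊥-elim (u≉0 (≈-by-differences R (solve 1 (λ u → 𝟎 :- (:- u) := u :- 𝟎) refl u) (sym -u≈0)))
      where
      -u≈0 : - u ≈ 0#
      -u≈0 = trans -u≈u+2 (trans (solve 1 (λ u → u :+ 𝟐 := 𝟑 :+ ((u :- 𝟏) :+ 𝟎)) refl u) eval≈0)

    evaluate-injective : ∀ {p q} → evaluate p ≈ evaluate q → p ≡ q
    evaluate-injective {p} {q} eval-p≈eval-q = GroupProperties.x∙y⁻¹≈ε⇒x≈y Z.+-group p q (evaluate-kernel (p Z.- q) (begin
      evaluate (p Z.- q)             ≈⟨ evaluate-+ p (Z.- q) ⟩
      evaluate p + evaluate (Z.- q)  ≈⟨ +-cong eval-p≈eval-q (evaluate-negate q) ⟩
      evaluate q - evaluate q        ≈⟨ -‿inverseʳ (evaluate q) ⟩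
      0#                             ∎))

    evaluate-isRingMonomorphism : RingMorphisms.IsRingMonomorphism Z.rawRing rawRing evaluate
    evaluate-isRingMonomorphism = record
      { isRingHomomorphism = evaluate-isRingHomomorphism
      ; injective = evaluate-injective
      }

    involution-preimage : ∀ {w} → Involution R w → ∃ λ p → w ≈ evaluate p
    involution-preimage w²≈1 = preimage (involutions-exhausted w²≈1)
      where
      preimage : ∀ {w} → w ≈ 1# ⊎ w ≈ - 1# ⊎ w ≈ u ⊎ w ≈ - u → ∃ λ p → w ≈ evaluate p
      preimage (inj₁ w≈1) = (# 1 , # 0) , trans w≈1 (sym (+-identityʳ 1#))
      preimage (inj₂ (inj₁ w≈-1)) = (# 3 , # 0) , trans w≈-1 (solve 0 (:- 𝟏 := 𝟑 :+ 𝟎) refl)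
      preimage (inj₂ (inj₂ (inj₁ w≈u))) = (# 1 , # 1) , trans w≈u (solve 1 (λ u → u := 𝟏 :+ ((u :- 𝟏) :+ 𝟎)) refl u)
      preimage (inj₂ (inj₂ (inj₂ w≈-u))) =
        (# 3 , # 1) , trans w≈-u (trans -u≈u+2 (solve 1 (λ u → u :+ 𝟐 := 𝟑 :+ ((u :- 𝟏) :+ 𝟎)) refl u))

    sum-preimage : ∀ {ws} → All (Involution R) ws → ∃ λ p → sum R ws ≈ evaluate p
    sum-preimage [] = Z.0# , sym evaluate-0
    sum-preimage (w²≈1 ∷ involutions) =
      let p , w≈eval-p = involution-preimage w²≈1
          q , Σ≈eval-q = sum-preimage involutions
      in p Z.+ q , trans (+-cong w≈eval-p Σ≈eval-q) (sym (evaluate-+ p q))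

    preimage : ∀ x → ∃ λ p → x ≈ evaluate p
    preimage x =
      let us , involutions , x≈Σus = sums x
          p , Σus≈eval-p = sum-preimage involutions
      in p , trans x≈Σus Σus≈eval-p

    evaluate-inverse : rawRing ≅ᵣ Z4x
    evaluate-inverse =
      proj₁ ∘ preimage ,
      section-isRingIsomorphism R Z4x-commutativeRing evaluate-isRingMonomorphism (λ x → sym (proj₂ (preimage x)))

  ≅Z4x : rawRing ≅ᵣ Z4x
  ≅Z4x = let u , 0~u , u≉1 , u≉-1 = fresh-neighbour (neighbour 1²≈1) (neighbour -1²≈1)
         in evaluate-inverse (Equivalence.to (Adj-0⇔Involution R 1≉0) 0~u) u≉1 u≉-1

lemma2p7 : ∀ {c ℓ} (R : CommutativeRing c ℓ) →
    Finite R → IsLocal R → HasCharacteristic R 4 →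
    ((Connected R × Regular R 4) ⇔ (CommutativeRing.rawRing R ≅ᵣ Z4x))
lemma2p7 R _ _ char4 = mk⇔
  (λ (connected , regular) → Recognition.≅Z4x R char4 connected regular)
  (λ (_ , iso) → Connected-reflect R Z4x-commutativeRing iso Z4x-connected
               , Regular-reflect R Z4x-commutativeRing iso Z4x-regular)
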